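{- Let $n\ge 3$, let $p_1,\dots,p_n$ be distinct atoms, and let $\Gamma^n$ be the set of $\mathcal H$-formulas consisting of $\forall(p_i,\overline{\forall p_{i+1}})$ for $1\le i<n$; $\forall(p_1,\forall p_n)$; $\forall(p_n,\forall p_1)$; $\forall(p_i,p_i)$ for $1\le i\le n$; and $\forall(p_1,\bar p_{n-1})$. For $1\le h\le n-2$ let $\Gamma^n_h=\Gamma^n\setminus\{\forall(p_h,\overline{\forall p_{h+1}})\}$. Let $\phi$ be an $\mathcal H$-formula featuring only the atoms $p_1,\dots,p_n$, and let $1\le h\le n-2$. Then either $\Gamma^n_h\not\models\phi$ or $\phi\in\Gamma^n$.
   Context: A literal is $p$ or $\bar p$ with $p$ an atom. A structure $\mathfrak{A}$ consists of a non-empty set $A$ together with a subset $p^{\mathfrak A}\subseteq A$ for every atom $p$; $\bar p^{\mathfrak A}=A\setminus p^{\mathfrak A}$. A c-term is a literal or $\forall p$ or $\overline{\forall p}$ with $p$ an atom; bar is the involution $p\leftrightarrow\bar p$, $\forall p\leftrightarrow\overline{\forall p}$. $(\forall \ell)^{\mathfrak A}=\{a\in A: a=b \text{ for all } b\in\ell^{\mathfrak A}\}$, $(\overline{\forall\ell})^{\mathfrak A}=A\setminus(\forall\ell)^{\mathfrak A}$. An $\mathcal H$-formula is $\forall(p,c)$, $\forall(c,\bar p)$, $\exists(p,c)$ or $\exists(c,p)$ with $p$ an atom and $c$ a c-term. $\mathfrak A\models\forall(e,f)$ iff $e^{\mathfrak A}\subseteq f^{\mathfrak A}$; $\mathfrak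 A\models\exists(e,f)$ iff $e^{\mathfrak A}\cap f^{\mathfrak A}\ne\emptyset$. The formulas $\exists(e,f)$ and $\exists(f,e)$ are identified, as are $\forall(e,f)$ and $\forall(\bar f,\bar e)$ (membership in $\Gamma^n$ is understood up to these identifications). $\Theta\models\phi$ means every structure satisfying all formulas of $\Theta$ satisfies $\phi$. -}

module Defs where

open import Data.Nat using (ℕ; suc; _∸_; _≤_; _<_)
open import Data.Product using (Σ; _×_; ∃)
open import Data.Sum using (_⊎_)
open import Relation.Binary.PropositionalEquality using (_≡_)
open import Relation.Nullary using (¬_)
open import Level using (Level)

data CTerm (Atom : Set) : Set where
  pos  : Atom → CTerm Atom
  neg  : Atom → CTerm Atom
  all  : Atom → CTerm Atom
  nall : Atom → CTerm Atom

bar : {Atom : Set} → CTerm Atom → CTerm Atom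
bar (pos p)  = neg p
bar (neg p)  = pos p
bar (all p)  = nall p
bar (nall p) = all p

data Formula (Atom : Set) : Set where
  All : CTerm Atom → CTerm Atom → Formula Atom
  Ex  : CTerm Atom → CTerm Atom → Formula Atom

data IsH {Atom : Set} : Formula Atom → Set where
  h∀₁ : ∀ p c → IsH (All (pos p) c)
  h∀₂ : ∀ c p → IsH (All c (neg p))
  h∃₁ : ∀ p c → IsH (Ex (pos p) c)
  h∃₂ : ∀ c p → IsH (Ex c (pos p))

record Structure (Atom : Set) : Set₁ where
  field
    Carrier : Set
    elt     : Carrier          -- non-emptiness witness
    interp  : Atom → Carrier → Set

open Structure public

⟦_⟧ : {Atom : Set} → CTerm Atom → (𝔄 : Structure Atom) → Carrier 𝔄 → Set
⟦ pos p  ⟧ 𝔄 a = interp 𝔄 p a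
⟦ neg p  ⟧ 𝔄 a = ¬ interp 𝔄 p a
⟦ all p  ⟧ 𝔄 a = ∀ b → interp 𝔄 p b → a ≡ b
⟦ nall p ⟧ 𝔄 a = ¬ (∀ b → interp 𝔄 p b → a ≡ b)

_⊨_ : {Atom : Set} → Structure Atom → Formula Atom → Set
𝔄 ⊨ All e f = ∀ a → ⟦ e ⟧ 𝔄 a → ⟦ f ⟧ 𝔄 a
𝔄 ⊨ Ex e f  = Σ (Carrier 𝔄) λ a → ⟦ e ⟧ 𝔄 a × ⟦ f ⟧ 𝔄 a

_⊨ₛ_ : {Atom : Set} → (Formula Atom → Set) → Formula Atom → Set₁
Θ ⊨ₛ φ = ∀ (𝔄 : Structure _) → (∀ ψ → Θ ψ → 𝔄 ⊨ ψ) → 𝔄 ⊨ φ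

data Ident {Atom : Set} : Formula Atom → Formula Atom → Set where
  same   : ∀ φ → Ident φ φ
  contra : ∀ e f → Ident (All e f) (All (bar f) (bar e))
  swap   : ∀ e f → Ident (Ex e f) (Ex f e)

-- Γⁿ (as a predicate on formula representatives); atoms p₁..pₙ given by p : ℕ → Atom
data Γ {Atom : Set} (p : ℕ → Atom) (n : ℕ) : Formula Atom → Set where
  γ₁ : ∀ i → 1 ≤ i → i < n → Γ p n (All (pos (p i)) (nall (p (suc i))))
  γ₂ : Γ p n (All (pos (p 1)) (all (p n)))
  γ₃ : Γ p n (All (pos (p n)) (all (p 1)))
  γ₄ : ∀ i → 1 ≤ i → i ≤ n → Γ p n (All (pos (p i)) (pos (p i)))
  γ₅ : Γ p n (All (pos (p 1)) (neg (p (n ∸ 1))))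

_∈Γ[_,_] : {Atom : Set} → Formula Atom → (ℕ → Atom) → ℕ → Set
φ ∈Γ[ p , n ] = Σ _ λ ψ → Γ p n ψ × Ident φ ψ

Γh : {Atom : Set} → (ℕ → Atom) → ℕ → ℕ → Formula _ → Set
Γh p n h ψ = Γ p n ψ × ¬ Ident ψ (All (pos (p h)) (nall (p (suc h))))

atomOf : {Atom : Set} → CTerm Atom → Atom
atomOf (pos q)  = q
atomOf (neg q)  = q
atomOf (all q)  = q
atomOf (nall q) = q

AmongP : {Atom : Set} → (ℕ → Atom) → ℕ → Atom → Set
AmongP p n q = Σ ℕ λ i → 1 ≤ i × i ≤ n × p i ≡ q

OnlyAtoms : {Atom : Set} → (ℕ → Atom) → ℕ → Formula Atom → Set
OnlyAtoms p n (All e f) = AmongP p n (atomOf e) × AmongP p n (atomOf f)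
OnlyAtoms p n (Ex e f)  = AmongP p n (atomOf e) × AmongP p n (atomOf f)

module Submission where

-- Every H-formula over p₁ … pₙ is either in Γⁿ (up to the
-- identifications) or has a countermodel satisfying Γⁿ_h; the theorem follows
-- at once.  All countermodels are "level models": a family of sets
-- P₁, …, Pₙ ⊆ ℕ read as the extensions of p₁, …, pₙ, subject to three
-- closure conditions that make them satisfy every formula of Γⁿ_h.
--
-- Existential formulas are refuted by the empty
--     model.

open import Defs
open import Data.Nat using (ℕ; _≤_; _∸_)
open import Relation.Binary.PropositionalEquality using (_≡_)

open import Data.Nat using (zero; suc; _<_; z≤n; s≤s; _≟_; _≤?_)
open import Data.Nat.Properties
  using (≤-refl; ≤-trans; ≤-antisym; ≤-pred; <⇒≢; <⇒≤; ≤∧≢⇒<; ≰⇒>; m≤n⇒m≤1+n; n≤1+n; 1+n≰n)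
open import Data.Product using (Σ; _×_; _,_; proj₁; proj₂)
open import Data.Sum using (_⊎_; inj₁; inj₂; map₂)
open import Data.Empty using (⊥; ⊥-elim)
open import Data.Unit using (⊤; tt)
open import Relation.Nullary using (¬_; yes; no)
open import Relation.Binary.PropositionalEquality using (refl; sym; trans; cong; subst; subst₂; _≢_)

module _ {Atom : Set} where

  bar-bar : (c : CTerm Atom) → bar (bar c) ≡ c
  bar-bar (pos _)  = refl
  bar-bar (neg _)  = refl
  bar-bar (all _)  = refl
  bar-bar (nall _) = refl

  atomOf-bar : (c : CTerm Atom) → atomOf (bar c) ≡ atomOf c
  atomOf-bar (pos _)  = refl
  atomOf-bar (neg _)  = refl
  atomOf-bar (all _)  = refl
  atomOf-bar (nall _) = refl

  bar-excludes : (𝔄 : Structure Atom) (c : CTerm Atom) {a : Carrier 𝔄}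
    → ⟦ bar c ⟧ 𝔄 a → ¬ ⟦ c ⟧ 𝔄 a
  bar-excludes 𝔄 (pos _)  x y = x y
  bar-excludes 𝔄 (neg _)  x y = y x
  bar-excludes 𝔄 (all _)  x y = x y
  bar-excludes 𝔄 (nall _) x y = y x

  -- A counterexample to ∀(e,f): an element of e lying in f̄.  This positive
  -- form (rather than ¬ 𝔄 ⊨ ∀(e,f)) is needed to pass to the contrapositive
  -- constructively.
  Counter : (𝔄 : Structure Atom) → CTerm Atom → CTerm Atom → Set
  Counter 𝔄 e f = Σ (Carrier 𝔄) λ a → ⟦ e ⟧ 𝔄 a × ⟦ bar f ⟧ 𝔄 a

  counter-refutes : (𝔄 : Structure Atom) (e f : CTerm Atom) → Counter 𝔄 e f → ¬ 𝔄 ⊨ All e f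
  counter-refutes 𝔄 e f (a , a∈e , a∈f̄) sat = bar-excludes 𝔄 f a∈f̄ (sat a a∈e)

  counter-contra : (𝔄 : Structure Atom) (e f : CTerm Atom)
    → Counter 𝔄 e f → Counter 𝔄 (bar f) (bar e)
  counter-contra 𝔄 e f (a , a∈e , a∈f̄) =
    a , a∈f̄ , subst (λ c → ⟦ c ⟧ 𝔄 a) (sym (bar-bar e)) a∈e

  ∈Γ-contra : {p : ℕ → Atom} {n : ℕ} (e f : CTerm Atom)
    → All e f ∈Γ[ p , n ] → All (bar f) (bar e) ∈Γ[ p , n ]
  ∈Γ-contra e f (ψ , ψ∈Γ , same _) =
    ψ , ψ∈Γ , subst₂ (λ e′ f′ → Ident (All (bar f) (bar e)) (All e′ f′))
                     (bar-bar e) (bar-bar f) (contra (bar f) (bar e))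
  ∈Γ-contra e f (ψ , ψ∈Γ , contra _ _) = ψ , ψ∈Γ , same _

module Classification {Atom : Set} (m : ℕ) (p : ℕ → Atom)
  (p-injective : ∀ i j → 1 ≤ i → i ≤ suc (suc (suc m)) → 1 ≤ j → j ≤ suc (suc (suc m))
                   → p i ≡ p j → i ≡ j)
  (h : ℕ) (1≤h : 1 ≤ h) (h≤n-2 : h ≤ suc m) where

  n n-1 : ℕ
  n   = suc (suc (suc m))
  n-1 = suc (suc m)

  -- A level model: `holds k a` says that a is in the extension of pₖ.  The
  -- fields are exactly what Γⁿ_h demands beyond the trivial ∀(pᵢ,pᵢ).
  record LevelModel : Set₁ where
    field
      holds    : ℕ → ℕ → Set
      -- ∀(pₖ, \overline{∀pₖ₊₁}) for k ≠ h: pₖ₊₁ has an element other than a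
      step     : ∀ k a → 1 ≤ k → k < n → k ≢ h → holds k a
                   → Σ ℕ λ b → holds (suc k) b × a ≢ b
      -- ∀(p₁,∀pₙ) and ∀(pₙ,∀p₁)
      ends     : ∀ a b → holds 1 a → holds n b → a ≡ b
      -- ∀(p₁, p̄ₙ₋₁)
      disjoint : ∀ a → holds 1 a → holds n-1 a → ⊥
  open LevelModel

  structure : LevelModel → Structure Atom
  structure M = record
    { Carrier = ℕ ; elt = 0
    ; interp  = λ q a → Σ ℕ λ k → 1 ≤ k × k ≤ n × p k ≡ q × holds M k a }

  level→atom : ∀ M {k a} → 1 ≤ k → k ≤ n → holds M k a → interp (structure M) (p k) a
  level→atom M {k} 1≤k k≤n a∈k = k , 1≤k , k≤n , refl , a∈k

  -- Reading an atom back as a level uses that p is injective on 1 … n.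
  atom→level : ∀ M {k a} → 1 ≤ k → k ≤ n → interp (structure M) (p k) a → holds M k a
  atom→level M {k} 1≤k k≤n (k′ , 1≤k′ , k′≤n , pk′≡pk , a∈k′)
    with p-injective k′ k 1≤k′ k′≤n 1≤k k≤n pk′≡pk
  ... | refl = a∈k′

  1≤suc : ∀ {k} → 1 ≤ suc k
  1≤suc = s≤s z≤n

  satisfies-Γh : ∀ M ψ → Γh p n h ψ → structure M ⊨ ψ
  satisfies-Γh M _ (γ₁ i 1≤i i<n , not-removed) a a∈i all-equal =
    let (b , b∈i+1 , a≢b) = step M i a 1≤i i<n i≢h (atom→level M 1≤i (<⇒≤ i<n) a∈i)
    in a≢b (all-equal b (level→atom M 1≤suc i<n b∈i+1))
    where
    i≢h : i ≢ h
    i≢h refl = not-removed (same _)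
  satisfies-Γh M _ (γ₂ , _) a a∈1 b b∈n =
    ends M a b (atom→level M 1≤suc 1≤suc a∈1) (atom→level M 1≤suc ≤-refl b∈n)
  satisfies-Γh M _ (γ₃ , _) a a∈n b b∈1 =
    sym (ends M b a (atom→level M 1≤suc 1≤suc b∈1) (atom→level M 1≤suc ≤-refl a∈n))
  satisfies-Γh M _ (γ₄ _ _ _ , _) a a∈i = a∈i
  satisfies-Γh M _ (γ₅ , _) a a∈1 a∈n-1 =
    disjoint M a (atom→level M 1≤suc 1≤suc a∈1) (atom→level M 1≤suc (n≤1+n _) a∈n-1)

  empty : LevelModel
  empty = record { holds = λ _ _ → ⊥ ; step = λ _ _ _ _ _ () ; ends = λ _ _ () ; disjoint = λ _ () }

  empty-atoms : ∀ q a → ¬ interp (structure empty) q a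
  empty-atoms _ _ (_ , _ , _ , _ , ())

  -- Bands: intervals of levels [lo, hi] whose step condition can only fail at
  -- h or n, and which never contain level 1 together with level n-1 or n.
  data Band : ℕ → ℕ → Set where
    head : Band 1 h
    tail : ∀ {lo} → 2 ≤ lo → Band lo n

  band-step : ∀ {lo hi k} → Band lo hi → k < n → k ≢ h → k ≤ hi → suc k ≤ hi
  band-step head       k<n k≢h k≤h = ≤∧≢⇒< k≤h k≢h
  band-step (tail 2≤lo) k<n k≢h k≤n = k<n

  band-short : ∀ {lo hi} → Band lo hi → lo ≤ 1 → hi < n-1
  band-short head        _    = s≤s h≤n-2
  band-short (tail 2≤lo) lo≤1 = ⊥-elim (1+n≰n (≤-trans 2≤lo lo≤1))

  band-from : ∀ i → 1 ≤ i → i ≤ n → Σ ℕ λ hi → Band i hi × i ≤ hi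
  band-from (suc zero)    _ _   = h , head , 1≤h
  band-from (suc (suc i)) _ i≤n = n , tail (s≤s (s≤s z≤n)) , i≤n

  band : ∀ {lo hi} → Band lo hi → (Q : ℕ → ℕ → Set)
    → (∀ k a → lo ≤ k → suc k ≤ hi → Q k a → Σ ℕ λ b → Q (suc k) b × a ≢ b) → LevelModel
  band {lo} {hi} B Q Q-step = record
    { holds = λ k a → lo ≤ k × k ≤ hi × Q k a ; step = band-step′ ; ends = ends′ ; disjoint = disjoint′ }
    where
    band-step′ : ∀ k a → 1 ≤ k → k < n → k ≢ h → lo ≤ k × k ≤ hi × Q k a
      → Σ ℕ λ b → (lo ≤ suc k × suc k ≤ hi × Q (suc k) b) × a ≢ b
    band-step′ k a _ k<n k≢h (lo≤k , k≤hi , Qka) =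
      let k+1≤hi = band-step B k<n k≢h k≤hi
          (b , Qb , a≢b) = Q-step k a lo≤k k+1≤hi Qka
      in b , (m≤n⇒m≤1+n lo≤k , k+1≤hi , Qb) , a≢b
    ends′ : ∀ a b → lo ≤ 1 × 1 ≤ hi × Q 1 a → lo ≤ n × n ≤ hi × Q n b → a ≡ b
    ends′ _ _ (lo≤1 , _) (_ , n≤hi , _) =
      ⊥-elim (1+n≰n (≤-trans (band-short B lo≤1) (≤-trans (n≤1+n _) n≤hi)))
    disjoint′ : ∀ a → lo ≤ 1 × 1 ≤ hi × Q 1 a → lo ≤ n-1 × n-1 ≤ hi × Q n-1 a → ⊥
    disjoint′ _ (lo≤1 , _) (_ , n-1≤hi , _) = 1+n≰n (≤-trans (band-short B lo≤1) n-1≤hi)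

  full : ∀ {lo hi} → Band lo hi → LevelModel
  full B = band B (λ _ _ → ⊤) (λ _ a _ _ _ → suc a , tt , <⇒≢ ≤-refl)

  full-holds : ∀ {lo hi} (B : Band lo hi) {k} a → lo ≤ k → k ≤ hi → holds (full B) k a
  full-holds B a lo≤k k≤hi = lo≤k , k≤hi , tt

  tail₂ : Band 2 n
  tail₂ = tail ≤-refl

  graph : ∀ i → 1 ≤ i → i ≤ n → (r : ℕ → ℕ) → (∀ k → i ≤ k → r k ≢ r (suc k)) → LevelModel
  graph i 1≤i i≤n r r-step =
    band (proj₁ (proj₂ (band-from i 1≤i i≤n))) (λ k a → a ≡ r k)
      (λ k a i≤k _ a≡rk → r (suc k) , refl , λ a≡rk+1 → r-step k i≤k (trans (sym a≡rk) a≡rk+1))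

  graph-start : ∀ i 1≤i i≤n r r-step → holds (graph i 1≤i i≤n r r-step) i (r i)
  graph-start i 1≤i i≤n r r-step = ≤-refl , proj₂ (proj₂ (band-from i 1≤i i≤n)) , refl

  graph-only : ∀ i 1≤i i≤n r r-step {k a} → holds (graph i 1≤i i≤n r r-step) k a → a ≡ r k
  graph-only i 1≤i i≤n r r-step (_ , _ , a≡rk) = a≡rk

  collapse : ℕ → ℕ → ℕ → ℕ
  collapse i j k with k ≟ j
  ... | yes _ = i
  ... | no _  = k

  collapse-i : ∀ i j → collapse i j i ≡ i
  collapse-i i j with i ≟ j
  ... | yes _ = refl
  ... | no _  = refl

  collapse-j : ∀ i j → collapse i j j ≡ i
  collapse-j i j with j ≟ j
  ... | yes _    = refl
  ... | no j≢j = ⊥-elim (j≢j refl)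

  collapse-step : ∀ i j k → i ≤ k → j ≢ suc i → collapse i j k ≢ collapse i j (suc k)
  collapse-step i j k i≤k j≢i+1 with k ≟ j | suc k ≟ j
  ... | yes refl | yes k+1≡k = ⊥-elim (<⇒≢ ≤-refl (sym k+1≡k))
  ... | yes refl | no _      = <⇒≢ (s≤s i≤k)
  ... | no _     | yes refl  = λ i≡k → j≢i+1 (cong suc i≡k)
  ... | no _     | no _      = <⇒≢ ≤-refl

  InG : ℕ → ℕ → Set
  InG k a = (a ≡ 0 × k ≢ n-1) ⊎ (a ≡ k × 2 ≤ k × k ≤ n-1)

  G-step : ∀ k a → 1 ≤ k → k < n → k ≢ h → InG k a → Σ ℕ λ b → InG (suc k) b × a ≢ b
  G-step k a 1≤k k<n _ a∈k with suc k ≤? n-1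
  ... | yes k+1≤n-1 = suc k , inj₂ (refl , s≤s 1≤k , k+1≤n-1) , a≢k+1 a∈k
    where
    a≢k+1 : InG k a → a ≢ suc k
    a≢k+1 (inj₁ (refl , _)) ()
    a≢k+1 (inj₂ (refl , _)) = <⇒≢ ≤-refl
  ... | no k+1≰n-1 = 0 , inj₁ (refl , λ k+1≡n-1 → <⇒≢ ≤-refl (sym (trans (cong suc (sym k≡n-1)) k+1≡n-1)))
                        , a≢0 a∈k
    where
    k≡n-1 : k ≡ n-1
    k≡n-1 = ≤-antisym (≤-pred k<n) (≤-pred (≰⇒> k+1≰n-1))
    a≢0 : InG k a → a ≢ 0
    a≢0 (inj₁ (_ , k≢n-1)) _       = k≢n-1 k≡n-1
    a≢0 (inj₂ (refl , () , _)) refl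

  G : LevelModel
  G = record { holds = InG ; step = G-step ; ends = G-ends ; disjoint = G-disjoint }
    where
    G-ends : ∀ a b → InG 1 a → InG n b → a ≡ b
    G-ends _ _ (inj₁ (refl , _)) (inj₁ (refl , _))    = refl
    G-ends _ _ (inj₁ _)          (inj₂ (_ , _ , n≤n-1)) = ⊥-elim (1+n≰n n≤n-1)
    G-ends _ _ (inj₂ (_ , s≤s () , _)) _
    G-disjoint : ∀ a → InG 1 a → InG n-1 a → ⊥
    G-disjoint _ _                        (inj₁ (_ , n-1≢n-1)) = n-1≢n-1 refl
    G-disjoint _ (inj₁ (refl , _))        (inj₂ (() , _))
    G-disjoint _ (inj₂ (_ , s≤s () , _)) (inj₂ _)

  G-zero : ∀ k → k ≢ n-1 → InG k 0
  G-zero k k≢n-1 = inj₁ (refl , k≢n-1)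

  G-self : ∀ k → 2 ≤ k → k ≤ n-1 → InG k k
  G-self k 2≤k k≤n-1 = inj₂ (refl , 2≤k , k≤n-1)

  Countermodel : CTerm Atom → CTerm Atom → Set₁
  Countermodel e f = Σ LevelModel λ M → Counter (structure M) e f

  Decided : CTerm Atom → CTerm Atom → Set₁
  Decided e f = All e f ∈Γ[ p , n ] ⊎ Countermodel e f

  decided-contra : ∀ e f → Decided e f → Decided (bar f) (bar e)
  decided-contra e f (inj₁ ∈Γ)           = inj₁ (∈Γ-contra e f ∈Γ)
  decided-contra e f (inj₂ (M , counter)) = inj₂ (M , counter-contra (structure M) e f counter)

  module Witnesses {i j} (1≤i : 1 ≤ i) (i≤n : i ≤ n) (1≤j : 1 ≤ j) (j≤n : j ≤ n) (M : LevelModel) where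

    outside : ∀ a → holds M i a → ¬ holds M j a → Countermodel (pos (p i)) (pos (p j))
    outside a a∈i a∉j = M , a , level→atom M 1≤i i≤n a∈i , λ a∈j → a∉j (atom→level M 1≤j j≤n a∈j)

    shared : ∀ a → holds M i a → holds M j a → Countermodel (pos (p i)) (neg (p j))
    shared a a∈i a∈j = M , a , level→atom M 1≤i i≤n a∈i , level→atom M 1≤j j≤n a∈j

    apart : ∀ a b → holds M i a → holds M j b → a ≢ b → Countermodel (pos (p i)) (all (p j))
    apart a b a∈i b∈j a≢b =
      M , a , level→atom M 1≤i i≤n a∈i , λ a-only → a≢b (a-only b (level→atom M 1≤j j≤n b∈j))

    alone : ∀ a → holds M i a → (∀ b → holds M j b → a ≡ b) → Countermodel (pos (p i)) (nall (p j))
    alone a a∈i a-only =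
      M , a , level→atom M 1≤i i≤n a∈i , λ b b∈j → a-only b (atom→level M 1≤j j≤n b∈j)

  open Witnesses

  -- ∀(pᵢ,pⱼ) holds only for i = j; otherwise the graph of the identity
  -- from level i puts i into pᵢ but not into pⱼ.
  decide-pos : ∀ i j → 1 ≤ i → i ≤ n → 1 ≤ j → j ≤ n → Decided (pos (p i)) (pos (p j))
  decide-pos i j 1≤i i≤n 1≤j j≤n with i ≟ j
  ... | yes refl = inj₁ (_ , γ₄ i 1≤i i≤n , same _)
  ... | no i≢j   = inj₂ (outside 1≤i i≤n 1≤j j≤n M i (graph-start i 1≤i i≤n _ id-step)
                          λ i∈j → i≢j (graph-only i 1≤i i≤n _ id-step i∈j))
    where
    id-step : ∀ k → i ≤ k → k ≢ suc k
    id-step k _ = <⇒≢ ≤-refl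
    M : LevelModel
    M = graph i 1≤i i≤n (λ k → k) id-step

  -- ∀(pᵢ,p̄ⱼ) holds only for {i,j} = {1,n-1}; otherwise G or the full tail
  -- band gives pᵢ and pⱼ a common element.
  decide-neg : ∀ i j → 1 ≤ i → i ≤ n → 1 ≤ j → j ≤ n → Decided (pos (p i)) (neg (p j))
  decide-neg (suc zero) j 1≤i i≤n 1≤j j≤n with j ≟ n-1
  ... | yes refl  = inj₁ (_ , γ₅ , same _)
  ... | no j≢n-1 = inj₂ (shared 1≤i i≤n 1≤j j≤n G 0 (G-zero 1 λ ()) (G-zero j j≢n-1))
  decide-neg (suc (suc i)) (suc zero) 1≤i i≤n 1≤j j≤n with suc (suc i) ≟ n-1
  ... | yes refl  = inj₁ (_ , γ₅ , contra (pos (p n-1)) (neg (p 1)))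
  ... | no i≢n-1 = inj₂ (shared 1≤i i≤n 1≤j j≤n G 0 (G-zero _ i≢n-1) (G-zero 1 λ ()))
  decide-neg (suc (suc i)) (suc (suc j)) 1≤i i≤n 1≤j j≤n =
    inj₂ (shared 1≤i i≤n 1≤j j≤n (full tail₂) 0
           (full-holds tail₂ 0 (s≤s (s≤s z≤n)) i≤n) (full-holds tail₂ 0 (s≤s (s≤s z≤n)) j≤n))

  -- ∀(pᵢ,∀pⱼ) holds only for {i,j} = {1,n}; otherwise G or a full band gives
  -- pᵢ and pⱼ two different elements.
  decide-all : ∀ i j → 1 ≤ i → i ≤ n → 1 ≤ j → j ≤ n → Decided (pos (p i)) (all (p j))
  decide-all (suc zero) (suc zero) 1≤i i≤n 1≤j j≤n =
    inj₂ (apart 1≤i i≤n 1≤j j≤n (full head) 0 1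
           (full-holds head 0 ≤-refl 1≤h) (full-holds head 1 ≤-refl 1≤h) λ ())
  decide-all (suc zero) (suc (suc j)) 1≤i i≤n 1≤j j≤n with suc (suc j) ≟ n
  ... | yes refl = inj₁ (_ , γ₂ , same _)
  ... | no j≢n   = inj₂ (apart 1≤i i≤n 1≤j j≤n G 0 _
                          (G-zero 1 λ ()) (G-self _ (s≤s (s≤s z≤n)) (≤-pred (≤∧≢⇒< j≤n j≢n))) λ ())
  decide-all (suc (suc i)) (suc zero) 1≤i i≤n 1≤j j≤n with suc (suc i) ≟ n
  ... | yes refl = inj₁ (_ , γ₃ , same _)
  ... | no i≢n   = inj₂ (apart 1≤i i≤n 1≤j j≤n G _ 0
                          (G-self _ (s≤s (s≤s z≤n)) (≤-pred (≤∧≢⇒< i≤n i≢n))) (G-zero 1 λ ()) λ ())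
  decide-all (suc (suc i)) (suc (suc j)) 1≤i i≤n 1≤j j≤n =
    inj₂ (apart 1≤i i≤n 1≤j j≤n (full tail₂) 0 1
           (full-holds tail₂ 0 (s≤s (s≤s z≤n)) i≤n) (full-holds tail₂ 1 (s≤s (s≤s z≤n)) j≤n) λ ())

  -- ∀(pᵢ,\overline{∀pⱼ}) holds only for j = i + 1; otherwise relabelling level j
  -- as i makes i the only possible element of pⱼ.
  decide-nall : ∀ i j → 1 ≤ i → i ≤ n → 1 ≤ j → j ≤ n → Decided (pos (p i)) (nall (p j))
  decide-nall i j 1≤i i≤n 1≤j j≤n with suc i ≟ j
  ... | yes refl   = inj₁ (_ , γ₁ i 1≤i j≤n , same _)
  ... | no i+1≢j = inj₂ (alone 1≤i i≤n 1≤j j≤n M i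
                           (subst (holds M i) (collapse-i i j) (graph-start i 1≤i i≤n _ collapse-steps))
                           λ b b∈j → sym (trans (graph-only i 1≤i i≤n _ collapse-steps b∈j) (collapse-j i j)))
    where
    collapse-steps : ∀ k → i ≤ k → collapse i j k ≢ collapse i j (suc k)
    collapse-steps k i≤k = collapse-step i j k i≤k (λ j≡i+1 → i+1≢j (sym j≡i+1))
    M : LevelModel
    M = graph i 1≤i i≤n (collapse i j) collapse-steps

  decide-∀ : ∀ i j → 1 ≤ i → i ≤ n → 1 ≤ j → j ≤ n → (c : CTerm Atom) → p j ≡ atomOf c
    → Decided (pos (p i)) c
  decide-∀ i j 1≤i i≤n 1≤j j≤n (pos _)  refl = decide-pos  i j 1≤i i≤n 1≤j j≤n
  decide-∀ i j 1≤i i≤n 1≤j j≤n (neg _)  refl = decide-neg  i j 1≤i i≤n 1≤j j≤n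
  decide-∀ i j 1≤i i≤n 1≤j j≤n (all _)  refl = decide-all  i j 1≤i i≤n 1≤j j≤n
  decide-∀ i j 1≤i i≤n 1≤j j≤n (nall _) refl = decide-nall i j 1≤i i≤n 1≤j j≤n

  Refutable : Formula Atom → Set₁
  Refutable φ = Σ LevelModel λ M → ¬ structure M ⊨ φ

  refute : ∀ {e f} → Decided e f → All e f ∈Γ[ p , n ] ⊎ Refutable (All e f)
  refute {e} {f} = map₂ λ { (M , counter) → M , counter-refutes (structure M) e f counter }

  -- Every H-formula over p₁ … pₙ is in Γⁿ or refuted by a level model.
  -- A formula ∀(c,p̄ᵢ) is decided through its contrapositive ∀(pᵢ,c̄).
  classify : (φ : Formula Atom) → IsH φ → OnlyAtoms p n φ → φ ∈Γ[ p , n ] ⊎ Refutable φ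
  classify _ (h∃₁ q c) _ = inj₂ (empty , λ (a , a∈q , _) → empty-atoms q a a∈q)
  classify _ (h∃₂ c q) _ = inj₂ (empty , λ (a , _ , a∈q) → empty-atoms q a a∈q)
  classify _ (h∀₁ _ c) ((i , 1≤i , i≤n , refl) , (j , 1≤j , j≤n , pj≡c)) =
    refute (decide-∀ i j 1≤i i≤n 1≤j j≤n c pj≡c)
  classify _ (h∀₂ c _) ((j , 1≤j , j≤n , pj≡c) , (i , 1≤i , i≤n , refl)) =
    refute (subst (λ d → Decided d (neg (p i))) (bar-bar c)
      (decided-contra (pos (p i)) (bar c)
        (decide-∀ i j 1≤i i≤n 1≤j j≤n (bar c) (trans pj≡c (sym (atomOf-bar c))))))

  entailed-in-Γ : (φ : Formula Atom) → IsH φ → OnlyAtoms p n φ → Γh p n h ⊨ₛ φ → φ ∈Γ[ p , n ]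
  entailed-in-Γ φ isH only entailed with classify φ isH only
  ... | inj₁ φ∈Γ        = φ∈Γ
  ... | inj₂ (M , ¬sat) = ⊥-elim (¬sat (entailed (structure M) (satisfies-Γh M)))

lemma4p2 : {Atom : Set} (n : ℕ) → 3 ≤ n → (p : ℕ → Atom)
    → (∀ i j → 1 ≤ i → i ≤ n → 1 ≤ j → j ≤ n → p i ≡ p j → i ≡ j)
    → (φ : Formula Atom) → IsH φ → OnlyAtoms p n φ
    → (h : ℕ) → 1 ≤ h → h ≤ n ∸ 2
    → Γh p n h ⊨ₛ φ → φ ∈Γ[ p , n ]
lemma4p2 (suc (suc (suc m))) _ p p-injective φ isH only h 1≤h h≤n-2 =
  Classification.entailed-in-Γ m p p-injective h 1≤h h≤n-2 φ isH only
lemma4p2 (suc zero)       (s≤s ())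
lemma4p2 (suc (suc zero)) (s≤s (s≤s ()))
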